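{- The integrality gap of the linear program $\min\{\sum_{\ell\in L}c(\ell)x_\ell: Mx\ge\mathbf 1,\ x\ge 0\}$ for DTAP is at least $\frac{6}{5}$; that is, there is an unweighted DTAP instance (all link costs equal to $1$) for which the minimum cardinality of a feasible link set is at least $\frac{6}{5}$ times the optimum value of this linear program.
   Context: An instance of DTAP consists of an oriented tree $T=(V,A)$ (directed graph whose underlying undirected graph is a tree) and links $L\subseteq V\times V$. For $\ell=(u,v)$, $P_\ell$ is the $u$-$v$ path in the underlying undirected tree traversed from $u$ to $v$, and $\ell$ covers exactly the arcs of $P_\ell$ traversed against their orientation (set $\overrightarrow{\mathrm{cov}}(\ell)$). A feasible solution is a link set covering every arc; DTAP asks for a minimum-cardinality feasible set. $M\in\{0,1\}^{A\times L}$ has $M_{a,\ell}=1$ iff $a\in\overrightarrow{\mathrm{cov}}(\ell)$. -}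

module Defs where

open import Data.Nat using (ℕ; zero; suc; _<_)
open import Data.Fin using (Fin; zero; suc)
open import Data.Fin.Subset using (Subset; _∈_; ∣_∣)
open import Data.Product using (_×_; proj₁; proj₂; Σ; ∃; _,_)
open import Data.List using (List; []; _∷_; _++_; length)
open import Data.List.Relation.Unary.Unique.Propositional using (Unique)
import Data.List.Membership.Propositional as LM
open import Data.Bool using (Bool; true)
open import Data.Integer using (+_)
open import Data.Rational using (ℚ; 0ℚ; 1ℚ; _+_; _*_; _≤_; _/_)
open import Relation.Binary.PropositionalEquality using (_≡_)
open import Function.Bundles using (_⇔_)

-- A directed (multi)graph on vertex set Fin n with arcs indexed by Fin m;
-- arc a goes from proj₁ (arcs a) to proj₂ (arcs a).
Arcs : ℕ → ℕ → Set
Arcs n m = Fin m → Fin n × Fin n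

-- Walks in the UNDERLYING undirected graph: each step traverses an arc either
-- along its orientation (fwd) or against it (bwd).
data Walk {n m : ℕ} (A : Arcs n m) : Fin n → Fin n → Set where
  []  : ∀ {u} → Walk A u u
  fwd : ∀ {u v} (a : Fin m) → proj₁ (A a) ≡ u → Walk A (proj₂ (A a)) v → Walk A u v
  bwd : ∀ {u v} (a : Fin m) → proj₂ (A a) ≡ u → Walk A (proj₁ (A a)) v → Walk A u v

module _ {n m : ℕ} {A : Arcs n m} where

  arcsOf : ∀ {u v} → Walk A u v → List (Fin m)
  arcsOf []          = []
  arcsOf (fwd a _ w) = a ∷ arcsOf w
  arcsOf (bwd a _ w) = a ∷ arcsOf w

  -- vertices reached after each step (excludes the start vertex)
  endsOf : ∀ {u v} → Walk A u v → List (Fin n)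
  endsOf []          = []
  endsOf (fwd a _ w) = proj₂ (A a) ∷ endsOf w
  endsOf (bwd a _ w) = proj₁ (A a) ∷ endsOf w

  backArcs : ∀ {u v} → Walk A u v → List (Fin m)
  backArcs []          = []
  backArcs (fwd a _ w) = backArcs w
  backArcs (bwd a _ w) = a ∷ backArcs w

  IsPath : ∀ {u v} → Walk A u v → Set
  IsPath {u} w = Unique (u ∷ endsOf w)

Connected : ∀ {n m} → Arcs n m → Set
Connected {n} A = (u v : Fin n) → Walk A u v

-- underlying undirected graph has no cycle: a closed walk with pairwise distinct
-- arcs and pairwise distinct vertices (the start/end vertex counted once) is empty.
Acyclic : ∀ {n m} → Arcs n m → Set
Acyclic {n} A = (v : Fin n) (w : Walk A v v) →
  Unique (arcsOf w) → Unique (endsOf w) → length (arcsOf w) ≡ 0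

IsOrientedTree : ∀ {n m} → Arcs n m → Set
IsOrientedTree {n} A = (0 < n) × Connected A × Acyclic A

Links : ℕ → ℕ → Set
Links n k = Fin k → Fin n × Fin n

-- arc a ∈ cov(ℓ): a is traversed against its orientation by the u-v path P_ℓ
-- (in a tree this path is unique).
Covers : ∀ {n m k} → Arcs n m → Links n k → Fin k → Fin m → Set
Covers A L ℓ a = Σ (Walk A (proj₁ (L ℓ)) (proj₂ (L ℓ)))
                   (λ w → IsPath w × a LM.∈ backArcs w)

Feasible : ∀ {n m k} → Arcs n m → Links n k → Subset k → Set
Feasible {m = m} A L S = (a : Fin m) → ∃ λ ℓ → ℓ ∈ S × Covers A L ℓ a

IsCoverageMatrix : ∀ {n m k} → Arcs n m → Links n k → (Fin m → Fin k → Bool) → Set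
IsCoverageMatrix {m = m} {k} A L M =
  (a : Fin m) (ℓ : Fin k) → (M a ℓ ≡ true) ⇔ Covers A L ℓ a

sumFin : ∀ {k} → (Fin k → ℚ) → ℚ
sumFin {zero}  f = 0ℚ
sumFin {suc k} f = f zero + sumFin (λ i → f (suc i))

b2q : Bool → ℚ
b2q true  = 1ℚ
b2q _     = 0ℚ

LPFeasible : ∀ {m k} → (Fin m → Fin k → Bool) → (Fin k → ℚ) → Set
LPFeasible {m} {k} M x =
  ((ℓ : Fin k) → 0ℚ ≤ x ℓ) × ((a : Fin m) → 1ℚ ≤ sumFin (λ ℓ → b2q (M a ℓ) * x ℓ))

-- unit costs: objective value Σ x_ℓ
lpValue : ∀ {k} → (Fin k → ℚ) → ℚ
lpValue = sumFin

toℚ : ℕ → ℚ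
toℚ c = + c / 1

{-# OPTIONS --safe #-}
module Submission where

open import Defs
open import Data.Nat as ℕ using (ℕ; _<_; z<s)
open import Data.Nat.Properties using (≮⇒≥; _<?_)
import Data.Nat.Coprimality as Coprime
open import Data.Fin using (Fin; _≟_)
open import Data.Fin.Patterns using (0F; 1F; 2F; 3F; 4F; 5F)
open import Data.Fin.Properties using (all?) renaming (any? to anyFin?)
open import Data.Fin.Subset using (Subset; ∣_∣; _∈_)
open import Data.Fin.Subset.Properties using (anySubset?) renaming (_∈?_ to _∈ₛ?_)
open import Data.Product using (Σ; ∃; _×_; _,_; proj₁; proj₂)
import Data.Product.Properties as Product
open import Data.Bool using (Bool; true)
import Data.Bool as Bool
open import Data.Integer as ℤ using (+_; +≤+)
import Data.Integer.Properties as ℤₚ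
open import Data.Rational using (ℚ; 0ℚ; 1ℚ; _≤_; _*_; _/_; *≤*)
open import Data.Rational.Properties using (_≤?_; normalize-coprime)
open import Data.List using (List; []; _∷_)
import Data.List.Properties as List
open import Data.List.Membership.Propositional using (_∉_) renaming (_∈_ to _∈ₗ_)
open import Data.List.Relation.Unary.Any using (here; any?)
open import Data.List.Relation.Unary.All using (_∷_)
open import Data.List.Relation.Unary.All.Properties using (All¬⇒¬Any)
open import Data.List.Relation.Unary.AllPairs using (_∷_)
open import Data.List.Relation.Unary.Unique.DecPropositional using (unique?)
open import Relation.Binary.Definitions using (DecidableEquality)
open import Relation.Nullary using (Dec; yes; no; does; contradiction)
open import Relation.Nullary.Decidable using (map′; ¬?; _×-dec_; _→-dec_; toWitnessFalse; from-yes)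
open import Relation.Binary.PropositionalEquality using (_≡_; refl; sym; trans; cong; subst; subst₂; module ≡-Reasoning)
open import Function using (_∘_)
open import Function.Bundles using (_⇔_; mk⇔; Equivalence)
open import Function.Construct.Composition using (_⇔-∘_)
open import Function.Construct.Symmetry using (⇔-sym)

-- Take the tree with arcs 2→0, 0→3, 1→0, 5→1, 1→4 and links 3→2, 3→1, 0→5,
-- 4→5, 4→2: link i covers exactly arcs i and i + 1 (mod 5), so M is the
-- incidence matrix of a 5-cycle.  Weight 1/2 on every link is a fractional
-- cover of value 5/2, whereas a feasible link set must cover five arcs with
-- links covering two arcs each, hence has at least 3 = 6/5 · 5/2 links.
--
-- Paths in the tree are controlled by a routing, a chosen walk between any two
-- vertices subject to local consistency conditions.  These conditions force
-- every path to agree with the routing, which gives acyclicity and reduces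
-- coverage to a computation; being decidable, they are checked by evaluation.

module _ {n m : ℕ} {A : Arcs n m} where

  src tgt : Fin m → Fin n
  src a = proj₁ (A a)
  tgt a = proj₂ (A a)

  Trace : Set
  Trace = List (Fin m) × List (Fin n) × List (Fin m)

  trace : ∀ {u v} → Walk A u v → Trace
  trace w = arcsOf w , endsOf w , backArcs w

  _≟-trace_ : DecidableEquality Trace
  _≟-trace_ = Product.≡-dec (List.≡-dec _≟_) (Product.≡-dec (List.≡-dec _≟_) (List.≡-dec _≟_))

  -- Stepping from an endpoint of arc a across a and then following the route
  -- is again the route, unless that route returns through the starting vertex.
  record IsRouting (route : Connected A) : Set where
    field
      route-refl : ∀ u → trace (route u u) ≡ ([] , [] , [])
      route-fwd  : ∀ a v → src a ∉ endsOf (route (tgt a) v) →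
                   trace (route (src a) v) ≡ trace (fwd a refl (route (tgt a) v))
      route-bwd  : ∀ a v → tgt a ∉ endsOf (route (src a) v) →
                   trace (route (tgt a) v) ≡ trace (bwd a refl (route (src a) v))
      route-path : ∀ u v → IsPath (route u v)

  isRouting? : (route : Connected A) → Dec (IsRouting route)
  isRouting? route = map′
    (λ (r , f , b , p) → record { route-refl = r ; route-fwd = f ; route-bwd = b ; route-path = p })
    (λ R → let open IsRouting R in route-refl , route-fwd , route-bwd , route-path)
    (all? (λ u → trace (route u u) ≟-trace _)
      ×-dec all? (λ a → all? λ v → ¬? (any? (src a ≟_) _) →-dec (_ ≟-trace _))
      ×-dec all? (λ a → all? λ v → ¬? (any? (tgt a ≟_) _) →-dec (_ ≟-trace _))
      ×-dec all? (λ u → all? λ v → unique? _≟_ _))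

  module _ {route : Connected A} (routing : IsRouting route) where
    open IsRouting routing
    open ≡-Reasoning

    path-trace : ∀ {u v} (w : Walk A u v) → IsPath w → trace w ≡ trace (route u v)
    path-trace {u} [] _ = sym (route-refl u)
    path-trace {v = v} (fwd a refl w) ((_ ∷ src∉w) ∷ w-path) = begin
      trace (fwd a refl w)                 ≡⟨ cong (λ (as , es , bs) → a ∷ as , tgt a ∷ es , bs) w≡route ⟩
      trace (fwd a refl (route (tgt a) v)) ≡⟨ route-fwd a v src∉route ⟨
      trace (route (src a) v)              ∎
      where
      w≡route = path-trace w w-path
      src∉route = subst (src a ∉_) (cong (proj₁ ∘ proj₂) w≡route) (All¬⇒¬Any src∉w)
    path-trace {v = v} (bwd a refl w) ((_ ∷ tgt∉w) ∷ w-path) = begin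
      trace (bwd a refl w)                 ≡⟨ cong (λ (as , es , bs) → a ∷ as , src a ∷ es , a ∷ bs) w≡route ⟩
      trace (bwd a refl (route (src a) v)) ≡⟨ route-bwd a v tgt∉route ⟨
      trace (route (tgt a) v)              ∎
      where
      w≡route = path-trace w w-path
      tgt∉route = subst (tgt a ∉_) (cong (proj₁ ∘ proj₂) w≡route) (All¬⇒¬Any tgt∉w)

    ∉-route-refl : ∀ x u → x ∉ endsOf (route u u)
    ∉-route-refl x u = (λ ()) ∘ subst (x ∈ₗ_) (cong (proj₁ ∘ proj₂) (route-refl u))

    route-against-arc : ∀ a → arcsOf (route (tgt a) (src a)) ≡ a ∷ []
    route-against-arc a = trans
      (cong proj₁ (route-bwd a (src a) (∉-route-refl (tgt a) (src a))))
      (cong ((a ∷_) ∘ proj₁) (route-refl (src a)))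

    route-along-arc : ∀ a → arcsOf (route (src a) (tgt a)) ≡ a ∷ []
    route-along-arc a = trans
      (cong proj₁ (route-fwd a (tgt a) (∉-route-refl (src a) (tgt a))))
      (cong ((a ∷_) ∘ proj₁) (route-refl (tgt a)))

    -- A cycle leaving v through arc a returns along a path, which must be the
    -- route back across a, so it uses a twice.
    routing⇒acyclic : Acyclic A
    routing⇒acyclic _ [] _ _ = refl
    routing⇒acyclic _ (fwd a refl w) (a∉w ∷ _) w-path = contradiction
      (subst (a ∈ₗ_) (sym (trans (cong proj₁ (path-trace w w-path)) (route-against-arc a))) (here refl))
      (All¬⇒¬Any a∉w)
    routing⇒acyclic _ (bwd a refl w) (a∉w ∷ _) w-path = contradiction
      (subst (a ∈ₗ_) (sym (trans (cong proj₁ (path-trace w w-path)) (route-along-arc a))) (here refl))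
      (All¬⇒¬Any a∉w)

    back-path⇔back-route : ∀ {u v a} →
      (Σ (Walk A u v) λ w → IsPath w × a ∈ₗ backArcs w) ⇔ a ∈ₗ backArcs (route u v)
    back-path⇔back-route {u} {v} = mk⇔
      (λ (w , w-path , a∈w) → subst (_ ∈ₗ_) (cong (proj₂ ∘ proj₂) (path-trace w w-path)) a∈w)
      (λ a∈route → route u v , route-path u v , a∈route)

does≡true⇔ : ∀ {P : Set} (p? : Dec P) → (does p? ≡ true) ⇔ P
does≡true⇔ (yes p) = mk⇔ (λ _ → p) (λ _ → refl)
does≡true⇔ (no ¬p) = mk⇔ (λ ()) (λ p → contradiction p ¬p)

routeMatrix : ∀ {n m k} {A : Arcs n m} → Connected A → Links n k → Fin m → Fin k → Bool
routeMatrix route L a ℓ = does (any? (a ≟_) (backArcs (route (proj₁ (L ℓ)) (proj₂ (L ℓ)))))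

routeMatrix-isCoverageMatrix : ∀ {n m k} {A : Arcs n m} {route : Connected A} →
  IsRouting route → (L : Links n k) → IsCoverageMatrix A L (routeMatrix route L)
routeMatrix-isCoverageMatrix routing L a ℓ =
  ⇔-sym (back-path⇔back-route routing) ⇔-∘ does≡true⇔ (any? (a ≟_) _)

SetCover : ∀ {m k} → (Fin m → Fin k → Bool) → Subset k → Set
SetCover {m} M S = (a : Fin m) → ∃ λ ℓ → ℓ ∈ S × M a ℓ ≡ true

setCover? : ∀ {m k} (M : Fin m → Fin k → Bool) (S : Subset k) → Dec (SetCover M S)
setCover? M S = all? λ a → anyFin? λ ℓ → ℓ ∈ₛ? S ×-dec M a ℓ Bool.≟ true

feasible⇒setCover : ∀ {n m k} {A : Arcs n m} {L : Links n k} {M S} →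
  IsCoverageMatrix A L M → Feasible A L S → SetCover M S
feasible⇒setCover isM feasible a =
  let ℓ , ℓ∈S , covers = feasible a in ℓ , ℓ∈S , Equivalence.from (isM a ℓ) covers

lpFeasible? : ∀ {m k} (M : Fin m → Fin k → Bool) (x : Fin k → ℚ) → Dec (LPFeasible M x)
lpFeasible? M x = all? (λ ℓ → 0ℚ ≤? x ℓ) ×-dec all? (λ a → 1ℚ ≤? sumFin λ ℓ → b2q (M a ℓ) * x ℓ)

toℚ-mono-≤ : ∀ {p q} → p ℕ.≤ q → toℚ p ≤ toℚ q
toℚ-mono-≤ {p} {q} p≤q
  rewrite normalize-coprime {p} {0} (Coprime.sym (Coprime.1-coprimeTo p))
        | normalize-coprime {q} {0} (Coprime.sym (Coprime.1-coprimeTo q))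
  = *≤* (subst₂ ℤ._≤_ (sym (ℤₚ.*-identityʳ (+ p))) (sym (ℤₚ.*-identityʳ (+ q))) (+≤+ p≤q))

tree : Arcs 6 5
tree 0F = 2F , 0F
tree 1F = 0F , 3F
tree 2F = 1F , 0F
tree 3F = 5F , 1F
tree 4F = 1F , 4F

links : Links 6 5
links 0F = 3F , 2F
links 1F = 3F , 1F
links 2F = 0F , 5F
links 3F = 4F , 5F
links 4F = 4F , 2F

treeRoute : Connected tree
treeRoute 0F 0F = []
treeRoute 0F 1F = bwd 2F refl []
treeRoute 0F 2F = bwd 0F refl []
treeRoute 0F 3F = fwd 1F refl []
treeRoute 0F 4F = bwd 2F refl (fwd 4F refl [])
treeRoute 0F 5F = bwd 2F refl (bwd 3F refl [])
treeRoute 1F 0F = fwd 2F refl []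
treeRoute 1F 1F = []
treeRoute 1F 2F = fwd 2F refl (bwd 0F refl [])
treeRoute 1F 3F = fwd 2F refl (fwd 1F refl [])
treeRoute 1F 4F = fwd 4F refl []
treeRoute 1F 5F = bwd 3F refl []
treeRoute 2F 0F = fwd 0F refl []
treeRoute 2F 1F = fwd 0F refl (bwd 2F refl [])
treeRoute 2F 2F = []
treeRoute 2F 3F = fwd 0F refl (fwd 1F refl [])
treeRoute 2F 4F = fwd 0F refl (bwd 2F refl (fwd 4F refl []))
treeRoute 2F 5F = fwd 0F refl (bwd 2F refl (bwd 3F refl []))
treeRoute 3F 0F = bwd 1F refl []
treeRoute 3F 1F = bwd 1F refl (bwd 2F refl [])
treeRoute 3F 2F = bwd 1F refl (bwd 0F refl [])
treeRoute 3F 3F = []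
treeRoute 3F 4F = bwd 1F refl (bwd 2F refl (fwd 4F refl []))
treeRoute 3F 5F = bwd 1F refl (bwd 2F refl (bwd 3F refl []))
treeRoute 4F 0F = bwd 4F refl (fwd 2F refl [])
treeRoute 4F 1F = bwd 4F refl []
treeRoute 4F 2F = bwd 4F refl (fwd 2F refl (bwd 0F refl []))
treeRoute 4F 3F = bwd 4F refl (fwd 2F refl (fwd 1F refl []))
treeRoute 4F 4F = []
treeRoute 4F 5F = bwd 4F refl (bwd 3F refl [])
treeRoute 5F 0F = fwd 3F refl (fwd 2F refl [])
treeRoute 5F 1F = fwd 3F refl []
treeRoute 5F 2F = fwd 3F refl (fwd 2F refl (bwd 0F refl []))
treeRoute 5F 3F = fwd 3F refl (fwd 2F refl (fwd 1F refl []))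
treeRoute 5F 4F = fwd 3F refl (fwd 4F refl [])
treeRoute 5F 5F = []

treeRouting : IsRouting treeRoute
treeRouting = from-yes (isRouting? treeRoute)

coverage : Fin 5 → Fin 5 → Bool
coverage = routeMatrix treeRoute links

half : Fin 5 → ℚ
half _ = + 1 / 2

half-lpFeasible : LPFeasible coverage half
half-lpFeasible = from-yes (lpFeasible? coverage half)

setCover⇒3≤∣S∣ : (S : Subset 5) → SetCover coverage S → 3 ℕ.≤ ∣ S ∣
setCover⇒3≤∣S∣ S cover = ≮⇒≥ λ small → toWitnessFalse
  {a? = anySubset? λ T → setCover? coverage T ×-dec ∣ T ∣ <? 3} _ (S , cover , small)

propositionA3 :
    Σ ℕ λ n → Σ ℕ λ m → Σ ℕ λ k →
    Σ (Arcs n m) λ A → Σ (Links n k) λ L → Σ (Fin m → Fin k → Bool) λ M →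
      IsOrientedTree A × (0 < m) × IsCoverageMatrix A L M ×
      (Σ (Fin k → ℚ) λ x → LPFeasible M x ×
        ((S : Subset k) → Feasible A L S → ((+ 6 / 5) * lpValue x) ≤ toℚ ∣ S ∣))
propositionA3 =
  6 , 5 , 5 , tree , links , coverage ,
  (z<s , treeRoute , routing⇒acyclic treeRouting) , z<s , isCoverage ,
  half , half-lpFeasible ,
  -- (+ 6 / 5) * lpValue half evaluates to toℚ 3.
  λ S feasible → toℚ-mono-≤ (setCover⇒3≤∣S∣ S (feasible⇒setCover isCoverage feasible))
  where isCoverage = routeMatrix-isCoverageMatrix treeRouting links
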